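{- Let $G$ be a graph, $S\subseteq V(G)$, $w\in V(G)$ and $k\geq 0$ an integer. If $t(G,S,w)\geq k$, then $t(G,S,w)\geq t(G,S\cup\{z\},w)\geq k$ for every $z\in N_{\geq k}(w)$. Consequently, $t(G,S,w)\geq t(G,S\cup N_{\geq k}(w),w)\geq k$.
   Context: All graphs are finite and simple. In 2-neighbor bootstrap percolation on $G$, given $S\subseteq V(G)$ one sets $S_{(0)}=S$ and $S_{(i+1)}=S_{(i)}\cup\{v: v \text{ has at least two neighbors in } S_{(i)}\}$. For a vertex $v$, $t(G,S,v)$ is the minimum $t$ with $v\in S_{(t)}$, and $t(G,S,v)=\infty$ if there is no such $t$. $N_{\geq k}(w)$ denotes the set of vertices at distance at least $k$ from $w$. -}

module Defs where

open import Level using (0ℓ)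
open import Data.Nat using (ℕ; zero; suc; _≤_; _<_)
open import Data.Fin using (Fin)
open import Data.Product using (Σ; _×_; ∃-syntax)
open import Data.Sum using (_⊎_)
open import Relation.Nullary using (¬_)
open import Relation.Binary.PropositionalEquality using (_≡_; _≢_)

record Graph : Set₁ where
  field
    n     : ℕ
    Adj   : Fin n → Fin n → Set
    sym   : ∀ {u v} → Adj u v → Adj v u
    irrefl : ∀ {v} → ¬ Adj v v

open Graph public

VSet : Graph → Set₁
VSet G = Fin (n G) → Set

_∪_ : {G : Graph} → VSet G → VSet G → VSet G
(A ∪ B) v = A v ⊎ B v

singleton : {G : Graph} → Fin (n G) → VSet G
singleton z v = v ≡ z

TwoNbrs : (G : Graph) → VSet G → Fin (n G) → Set
TwoNbrs G A v = ∃[ u ] ∃[ u' ] (u ≢ u' × Adj G v u × Adj G v u' × A u × A u')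

-- S_(i) of 2-neighbour bootstrap percolation.
Stage : (G : Graph) → VSet G → ℕ → VSet G
Stage G S zero    v = S v
Stage G S (suc i) v = Stage G S i v ⊎ TwoNbrs G (Stage G S i) v

data ℕ∞ : Set where
  fin : ℕ → ℕ∞
  ∞   : ℕ∞

data _≤∞_ : ℕ∞ → ℕ∞ → Set where
  fin≤fin : ∀ {a b} → a ≤ b → fin a ≤∞ fin b
  x≤∞     : ∀ {x} → x ≤∞ ∞

-- PercTime G S v τ  :  τ = t(G,S,v), i.e. τ is the minimum t with v ∈ S_(t),
-- or ∞ if there is no such t.
PercTime : (G : Graph) → VSet G → Fin (n G) → ℕ∞ → Set
PercTime G S v (fin m) = Stage G S m v × (∀ j → j < m → ¬ Stage G S j v)
PercTime G S v ∞       = ∀ j → ¬ Stage G S j v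

data Walk (G : Graph) : Fin (n G) → Fin (n G) → ℕ → Set where
  here : ∀ {v} → Walk G v v zero
  step : ∀ {u v w ℓ} → Adj G u v → Walk G v w ℓ → Walk G u w (suc ℓ)

-- dist(w,z) ≥ k : there is no walk (equivalently path) from w to z of length < k
-- (includes dist = ∞ for vertices in other components).
DistGE : (G : Graph) → Fin (n G) → ℕ → Fin (n G) → Set
DistGE G w k z = ∀ ℓ → ℓ < k → ¬ Walk G w z ℓ

N≥ : (G : Graph) → ℕ → Fin (n G) → VSet G
N≥ G k w z = DistGE G w k z

module Submission where

-- Bootstrap percolation is monotone in the initial set, and it is local:
-- a vertex infected by time i has been infected through vertices within distance i
-- of it.  So if every vertex of T that is not in S lies at distance ≥ k from w,
-- then during the first k − ℓ rounds the runs from S and from T agree at every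
-- vertex reachable from w by a walk of length ℓ.

open import Defs
open import Data.Nat using (ℕ; zero; suc; _+_; _<_)
open import Data.Nat.Properties using (≤-trans; +-suc; +-identityʳ; ≰⇒>; _≤?_; +-monoʳ-<; <-trans; n<1+n)
open import Data.Fin using (Fin)
open import Data.Product using (_×_; _,_)
open import Data.Sum using (_⊎_; inj₁; inj₂)
open import Data.Empty using (⊥-elim)
open import Relation.Nullary using (¬_; yes; no)
open import Relation.Binary.PropositionalEquality using (refl; subst)

_⊆_ : {G : Graph} → VSet G → VSet G → Set
_⊆_ {G} A B = ∀ v → A v → B v

walk-snoc : ∀ {G : Graph} {a b c ℓ} → Walk G a b ℓ → Adj G b c → Walk G a c (suc ℓ)
walk-snoc here         e = step e here
walk-snoc (step e' p)  e = step e' (walk-snoc p e)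

stage-mono : (G : Graph) (S T : VSet G) → _⊆_ {G} S T →
             ∀ i → _⊆_ {G} (Stage G S i) (Stage G T i)
stage-mono G S T S⊆T zero    v s = S⊆T v s
stage-mono G S T S⊆T (suc i) v (inj₁ s) = inj₁ (stage-mono G S T S⊆T i v s)
stage-mono G S T S⊆T (suc i) v (inj₂ (u , u' , u≢u' , vu , vu' , su , su')) =
  inj₂ (u , u' , u≢u' , vu , vu' , stage-mono G S T S⊆T i u su , stage-mono G S T S⊆T i u' su')

-- Locality: vertices of T outside S are at distance ≥ k from w, so they cannot
-- influence a vertex at walk-distance ℓ from w during the first k − ℓ rounds.
stage-local : (G : Graph) (S T : VSet G) (w : Fin (n G)) (k : ℕ) →
              (∀ v → T v → S v ⊎ N≥ G k w v) →
              ∀ i v ℓ → Walk G w v ℓ → ℓ + i < k → Stage G T i v → Stage G S i v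
stage-local G S T w k T⊆S∪far zero v ℓ p ℓ<k t with T⊆S∪far v t
... | inj₁ s   = s
... | inj₂ far = ⊥-elim (far ℓ (subst (_< k) (+-identityʳ ℓ) ℓ<k) p)
stage-local G S T w k T⊆S∪far (suc i) v ℓ p ℓ+1+i<k (inj₁ t) =
  inj₁ (stage-local G S T w k T⊆S∪far i v ℓ p ℓ+i<k t)
  where
  ℓ+i<k : ℓ + i < k
  ℓ+i<k = <-trans (+-monoʳ-< ℓ (n<1+n i)) ℓ+1+i<k
stage-local G S T w k T⊆S∪far (suc i) v ℓ p ℓ+1+i<k (inj₂ (u , u' , u≢u' , vu , vu' , tu , tu')) =
  inj₂ (u , u' , u≢u' , vu , vu' , recurse u vu tu , recurse u' vu' tu')
  where
  -- a neighbour of v is reached by a walk of length ℓ + 1, one round earlier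
  recurse : ∀ x → Adj G v x → Stage G T i x → Stage G S i x
  recurse x vx = stage-local G S T w k T⊆S∪far i x (suc ℓ) (walk-snoc p vx)
                   (subst (_< k) (+-suc ℓ i) ℓ+1+i<k)

time-antitone : (G : Graph) (S T : VSet G) (w : Fin (n G)) → _⊆_ {G} S T →
                ∀ τ τ' → PercTime G S w τ → PercTime G T w τ' → τ' ≤∞ τ
time-antitone G S T w S⊆T ∞       _        _        _ = x≤∞
time-antitone G S T w S⊆T (fin m) ∞        (sm , _) never =
  ⊥-elim (never m (stage-mono G S T S⊆T m w sm))
time-antitone G S T w S⊆T (fin m) (fin m') (sm , _) (_ , notBefore) with m' ≤? m
... | yes m'≤m = fin≤fin m'≤m
... | no  m'≰m = ⊥-elim (notBefore m (≰⇒> m'≰m) (stage-mono G S T S⊆T m w sm))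

time-lower : (G : Graph) (T : VSet G) (w : Fin (n G)) (k : ℕ) →
             (∀ j → j < k → ¬ Stage G T j w) →
             ∀ τ → PercTime G T w τ → fin k ≤∞ τ
time-lower G T w k notEarly ∞       _        = x≤∞
time-lower G T w k notEarly (fin m) (sm , _) with k ≤? m
... | yes k≤m = fin≤fin k≤m
... | no  k≰m = ⊥-elim (notEarly m (≰⇒> k≰m) sm)

time-ge⇒not-early : (G : Graph) (S : VSet G) (w : Fin (n G)) (k : ℕ) →
                    ∀ τ → PercTime G S w τ → fin k ≤∞ τ →
                    ∀ j → j < k → ¬ Stage G S j w
time-ge⇒not-early G S w k (fin m) (_ , notBefore) (fin≤fin k≤m) j j<k = notBefore j (≤-trans j<k k≤m)
time-ge⇒not-early G S w k ∞       never           _             j _   = never j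

adding-far-vertices :
  (G : Graph) (S T : VSet G) (w : Fin (n G)) (k : ℕ) →
  _⊆_ {G} S T → (∀ v → T v → S v ⊎ N≥ G k w v) →
  ∀ τ → PercTime G S w τ → fin k ≤∞ τ →
  ∀ τ' → PercTime G T w τ' → (τ' ≤∞ τ) × (fin k ≤∞ τ')
adding-far-vertices G S T w k S⊆T T⊆S∪far τ pt k≤τ τ' pt' =
    time-antitone G S T w S⊆T τ τ' pt pt'
  , time-lower G T w k notEarly τ' pt'
  where
  -- in round j < k, w ∈ T_(j) would give w ∈ S_(j) by locality (walk of length 0)
  notEarly : ∀ j → j < k → ¬ Stage G T j w
  notEarly j j<k tj = time-ge⇒not-early G S w k τ pt k≤τ j j<k
                        (stage-local G S T w k T⊆S∪far j w zero here j<k tj)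

lemma3 : (G : Graph) (S : VSet G) (w : Fin (n G)) (k : ℕ)
         (τ : ℕ∞) → PercTime G S w τ → fin k ≤∞ τ →
         ((z : Fin (n G)) → N≥ G k w z →
            (τ' : ℕ∞) → PercTime G (_∪_ {G} S (singleton {G} z)) w τ' →
            (τ' ≤∞ τ) × (fin k ≤∞ τ'))
         ×
         ((τ'' : ℕ∞) → PercTime G (_∪_ {G} S (N≥ G k w)) w τ'' →
            (τ'' ≤∞ τ) × (fin k ≤∞ τ''))
lemma3 G S w k τ pt k≤τ = addVertex , addAllFar
  where
  addVertex : (z : Fin (n G)) → N≥ G k w z →
              (τ' : ℕ∞) → PercTime G (_∪_ {G} S (singleton {G} z)) w τ' →
              (τ' ≤∞ τ) × (fin k ≤∞ τ')
  addVertex z zFar =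
    adding-far-vertices G S (_∪_ {G} S (singleton {G} z)) w k (λ v → inj₁)
      (λ { v (inj₁ s) → inj₁ s ; v (inj₂ refl) → inj₂ zFar }) τ pt k≤τ

  addAllFar : (τ'' : ℕ∞) → PercTime G (_∪_ {G} S (N≥ G k w)) w τ'' →
              (τ'' ≤∞ τ) × (fin k ≤∞ τ'')
  addAllFar = adding-far-vertices G S (_∪_ {G} S (N≥ G k w)) w k (λ v → inj₁) (λ v t → t) τ pt k≤τ
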